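{- For any integer $k\ge2$ there is no pair $(A,B)$ of finite subsets of $\{0,1,\dots,n\}$ (for any $n$) with $|A|=2,|B|=k$ or with $|A|=k,|B|=2$ such that $|A+B|>|(A-B)\cup(B-A)|$.
   Context: $A+B=\{a+b:a\in A,b\in B\}$, $A-B=\{a-b:a\in A,b\in B\}$. -}

module Defs where

open import Data.Nat using (ℕ)
open import Data.Nat.Properties using () renaming (_≟_ to _≟ℕ_)
open import Data.Integer using (ℤ; +_; _-_)
open import Data.Integer.Properties using () renaming (_≟_ to _≟ℤ_)
open import Data.List using (List; length; deduplicate; cartesianProductWith; _++_)

-- A finite set of naturals is represented by a duplicate-free list (see Statement).

sumList : List ℕ → List ℕ → List ℕ
sumList A B = cartesianProductWith Data.Nat._+_ A B

diffList : List ℕ → List ℕ → List ℤ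
diffList A B = cartesianProductWith (λ a b → (+ a) - (+ b)) A B

cardSum : List ℕ → List ℕ → ℕ
cardSum A B = length (deduplicate _≟ℕ_ (sumList A B))

cardDiffUnion : List ℕ → List ℕ → ℕ
cardDiffUnion A B = length (deduplicate _≟ℤ_ (diffList A B ++ diffList B A))

{-# OPTIONS --safe #-}
module Submission where

-- If A = {x, y}, the translation s ↦ s − (x + y) sends x + b to b − y and y + b to b − x,
-- so it injects A + B into B − A; symmetrically, if B = {x, y} it injects A + B into A − B.
-- Nothing is needed about the other set: not its size, its distinctness, nor the bound n.

open import Defs
open import Data.Nat using (ℕ; _+_; _≤_; _<_)
open import Data.Nat.Properties using (≤⇒≯; +-comm) renaming (_≟_ to _≟ℕ_)
open import Data.Integer using (ℤ; +_; _-_; -_; _⊖_)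
open import Data.Integer.Properties using (+-0-abelianGroup; +-injective; m-n≡m⊖n; +-cancelˡ-⊖)
  renaming (_≟_ to _≟ℤ_)
open import Algebra.Properties.AbelianGroup +-0-abelianGroup using (∙-cancelʳ)
open import Data.Fin using (zero; suc)
open import Data.Fin.Properties using (injective⇒≤)
open import Data.List using (List; []; _∷_; length; lookup; deduplicate; _++_)
open import Data.List.Relation.Unary.All using (All)
import Data.List.Relation.Unary.All as All
open import Data.List.Relation.Unary.Any using (here; there; index)
open import Data.List.Relation.Unary.AllPairs using (_∷_)
open import Data.List.Relation.Unary.Unique.Propositional using (Unique)
open import Data.List.Relation.Unary.Unique.DecPropositional.Properties using (deduplicate-!)
open import Data.List.Membership.Propositional using (_∈_)
open import Data.List.Membership.Propositional.Properties
  using (∈-lookup; ∈-cartesianProductWith⁺; ∈-cartesianProductWith⁻; ∈-deduplicate⁺; ∈-deduplicate⁻; ∈-++⁺ˡ; ∈-++⁺ʳ)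
open import Data.List.Membership.Setoid.Properties using (index-injective)
open import Data.Product using (_×_; _,_; ∃₂)
open import Data.Sum using (_⊎_; inj₁; inj₂)
open import Function.Definitions using (Injective)
open import Relation.Binary.PropositionalEquality
  using (_≡_; refl; sym; trans; cong; subst; setoid; module ≡-Reasoning)
open import Relation.Nullary using (¬_; contradiction)

Unique⇒lookup-injective : ∀ {a} {A : Set a} {xs : List A} → Unique xs → Injective _≡_ _≡_ (lookup xs)
Unique⇒lookup-injective {xs = _ ∷ _} _ {zero}  {zero}  _  = refl
Unique⇒lookup-injective (x∉ ∷ _)   {zero}  {suc j} eq = contradiction eq (All.lookup x∉ (∈-lookup j))
Unique⇒lookup-injective (x∉ ∷ _)   {suc i} {zero}  eq = contradiction (sym eq) (All.lookup x∉ (∈-lookup i))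
Unique⇒lookup-injective (_ ∷ uniq) {suc i} {suc j} eq = cong suc (Unique⇒lookup-injective uniq eq)

injection⇒length≤ : ∀ {a b} {A : Set a} {B : Set b} {f : A → B} → Injective _≡_ _≡_ f →
                    ∀ {xs ys} → Unique xs → (∀ {x} → x ∈ xs → f x ∈ ys) → length xs ≤ length ys
injection⇒length≤ {B = B} f-injective uniq f∈ =
  injective⇒≤ λ eq → Unique⇒lookup-injective uniq
    (f-injective (index-injective (setoid B) (f∈ (∈-lookup _)) (f∈ (∈-lookup _)) eq))

cardSum≤cardDiffUnion : ∀ {f : ℕ → ℤ} → Injective _≡_ _≡_ f → ∀ A B →
  (∀ {a b} → a ∈ A → b ∈ B → f (a + b) ∈ diffList A B ++ diffList B A) →
  cardSum A B ≤ cardDiffUnion A B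
cardSum≤cardDiffUnion {f} f-injective A B f[a+b]∈ =
  injection⇒length≤ f-injective (deduplicate-! _≟ℕ_ (sumList A B)) f∈
  where
  f∈ : ∀ {s} → s ∈ deduplicate _≟ℕ_ (sumList A B) →
       f s ∈ deduplicate _≟ℤ_ (diffList A B ++ diffList B A)
  f∈ s∈
    with a , b , a∈ , b∈ , refl ← ∈-cartesianProductWith⁻ _+_ A B (∈-deduplicate⁻ _≟ℕ_ (sumList A B) s∈)
    = ∈-deduplicate⁺ _≟ℤ_ (f[a+b]∈ a∈ b∈)

shiftBy : ℕ → ℕ → ℤ
shiftBy c s = + s - + c

shiftBy-injective : ∀ c → Injective _≡_ _≡_ (shiftBy c)
shiftBy-injective c {s} {t} eq = +-injective (∙-cancelʳ (- + c) (+ s) (+ t) eq)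

shiftBy-+-cancelˡ : ∀ x y b → shiftBy (x + y) (x + b) ≡ + b - + y
shiftBy-+-cancelˡ x y b = begin
  + (x + b) - + (x + y) ≡⟨ m-n≡m⊖n (x + b) (x + y) ⟩
  (x + b) ⊖ (x + y)     ≡⟨ +-cancelˡ-⊖ x b y ⟩
  b ⊖ y                 ≡⟨ sym (m-n≡m⊖n b y) ⟩
  + b - + y             ∎
  where open ≡-Reasoning

shiftBy-+-cancelʳ : ∀ x y b → shiftBy (x + y) (y + b) ≡ + b - + x
shiftBy-+-cancelʳ x y b = begin
  shiftBy (x + y) (y + b) ≡⟨ cong (λ c → shiftBy c (y + b)) (+-comm x y) ⟩
  shiftBy (y + x) (y + b) ≡⟨ shiftBy-+-cancelˡ y x b ⟩
  + b - + x               ∎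
  where open ≡-Reasoning

cardSum≤cardDiffUnion-pairˡ : ∀ x y B → cardSum (x ∷ y ∷ []) B ≤ cardDiffUnion (x ∷ y ∷ []) B
cardSum≤cardDiffUnion-pairˡ x y B =
  cardSum≤cardDiffUnion (shiftBy-injective (x + y)) (x ∷ y ∷ []) B shift∈
  where
  D : List ℤ
  D = diffList (x ∷ y ∷ []) B ++ diffList B (x ∷ y ∷ [])

  shift∈ : ∀ {a b} → a ∈ x ∷ y ∷ [] → b ∈ B → shiftBy (x + y) (a + b) ∈ D
  shift∈ {b = b} (here refl) b∈ =
    subst (_∈ D) (sym (shiftBy-+-cancelˡ x y b))
      (∈-++⁺ʳ _ (∈-cartesianProductWith⁺ _ b∈ (there (here refl))))
  shift∈ {b = b} (there (here refl)) b∈ =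
    subst (_∈ D) (sym (shiftBy-+-cancelʳ x y b))
      (∈-++⁺ʳ _ (∈-cartesianProductWith⁺ _ b∈ (here refl)))

cardSum≤cardDiffUnion-pairʳ : ∀ x y A → cardSum A (x ∷ y ∷ []) ≤ cardDiffUnion A (x ∷ y ∷ [])
cardSum≤cardDiffUnion-pairʳ x y A =
  cardSum≤cardDiffUnion (shiftBy-injective (x + y)) A (x ∷ y ∷ []) shift∈
  where
  D : List ℤ
  D = diffList A (x ∷ y ∷ []) ++ diffList (x ∷ y ∷ []) A

  shift∈ : ∀ {a b} → a ∈ A → b ∈ x ∷ y ∷ [] → shiftBy (x + y) (a + b) ∈ D
  shift∈ {a = a} a∈ (here refl) =
    subst (_∈ D) (sym (trans (cong (shiftBy (x + y)) (+-comm a x)) (shiftBy-+-cancelˡ x y a)))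
      (∈-++⁺ˡ (∈-cartesianProductWith⁺ _ a∈ (there (here refl))))
  shift∈ {a = a} a∈ (there (here refl)) =
    subst (_∈ D) (sym (trans (cong (shiftBy (x + y)) (+-comm a y)) (shiftBy-+-cancelʳ x y a)))
      (∈-++⁺ˡ (∈-cartesianProductWith⁺ _ a∈ (here refl)))

length≡2⇒pair : ∀ {a} {A : Set a} (xs : List A) → length xs ≡ 2 → ∃₂ λ x y → xs ≡ x ∷ y ∷ []
length≡2⇒pair (x ∷ y ∷ []) refl = x , y , refl

corollary5p2 : (k : ℕ) → 2 ≤ k → (n : ℕ) → (A B : List ℕ) →
    Unique A → Unique B → All (_≤ n) A → All (_≤ n) B →
    ((length A ≡ 2 × length B ≡ k) ⊎ (length A ≡ k × length B ≡ 2)) →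
    ¬ (cardDiffUnion A B < cardSum A B)
corollary5p2 _ _ _ A B _ _ _ _ (inj₁ (|A|≡2 , _)) with x , y , refl ← length≡2⇒pair A |A|≡2 =
  ≤⇒≯ (cardSum≤cardDiffUnion-pairˡ x y B)
corollary5p2 _ _ _ A B _ _ _ _ (inj₂ (_ , |B|≡2)) with x , y , refl ← length≡2⇒pair B |B|≡2 =
  ≤⇒≯ (cardSum≤cardDiffUnion-pairʳ x y A)
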